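{- Let $G$ be a finite simple graph with $F^-(G)=1$, and let $v\in V(G)$ be such that $\{v\}$ is a failed skew zero forcing set of $G$. Then $v$ has no neighbor of degree $2$.
   Context: Skew zero forcing: given a set $S\subseteq V(G)$ of colored vertices, the skew forcing rule says that if some vertex $w\in V(G)$ (colored or not) has exactly one neighbor $u$ not in $S$, then $u$ is added to $S$. A set $S$ is a failed skew zero forcing set if repeated application of this rule starting from $S$ does not result in all vertices of $G$ being in $S$. $F^-(G)$ is the maximum cardinality of a failed skew zero forcing set of $G$. -}

module Defs where

open import Data.Nat using (ℕ; _≤_)
open import Data.Bool using (Bool; true; false; T)
open import Data.Fin using (Fin)
open import Data.Fin.Subset using (Subset; _∈_; _∉_; ∣_∣; ⁅_⁆)
open import Data.Vec using (tabulate)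
open import Data.Product using (Σ; ∃; _×_)
open import Relation.Binary.PropositionalEquality using (_≡_; _≢_)
open import Relation.Nullary using (¬_)

record Graph (n : ℕ) : Set where
  field
    adj   : Fin n → Fin n → Bool
    sym   : ∀ u v → adj u v ≡ adj v u
    irrefl : ∀ v → adj v v ≡ false

open Graph public

Adj : ∀ {n} → Graph n → Fin n → Fin n → Set
Adj G u v = T (adj G u v)

nbhd : ∀ {n} → Graph n → Fin n → Subset n
nbhd G v = tabulate (adj G v)

degree : ∀ {n} → Graph n → Fin n → ℕ
degree G v = ∣ nbhd G v ∣

-- The set of vertices colored by repeatedly applying the skew forcing rule
-- starting from S (least set containing S and closed under the rule):
-- if some vertex w (colored or not) has all of its neighbours other than u
-- colored, where u is a neighbour of w, then u gets colored.
data Closure {n : ℕ} (G : Graph n) (S : Subset n) : Fin n → Set where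
  initial : ∀ {u} → u ∈ S → Closure G S u
  force   : ∀ {u} (w : Fin n) → Adj G w u →
            (∀ x → Adj G w x → x ≢ u → Closure G S x) →
            Closure G S u

FailedSkewZF : ∀ {n} → Graph n → Subset n → Set
FailedSkewZF G S = ∃ λ u → ¬ Closure G S u

FminusEq : ∀ {n} → Graph n → ℕ → Set
FminusEq {n} G k =
  (Σ (Subset n) λ S → FailedSkewZF G S × ∣ S ∣ ≡ k) ×
  (∀ (S : Subset n) → FailedSkewZF G S → ∣ S ∣ ≤ k)

-- Let u be a neighbour of v with exactly two neighbours, v and y. Once v is
-- colored, u forces y, so every vertex of N(u) = {v, y} is colored by the
-- closure of {v}. Hence the closure of N(u) is contained in that of {v}, so
-- N(u) is a failed skew zero forcing set of size 2 > F⁻(G) = 1.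
{-# OPTIONS --safe #-}
module Submission where

open import Defs hiding (sym)
open import Data.Nat using (ℕ; suc; _≤_; s≤s; z≤n)
open import Data.Nat.Properties using (≤-trans)
open import Data.Bool using (T)
open import Data.Bool.Properties using (T-≡)
open import Data.Fin using (Fin; _≟_)
open import Data.Fin.Subset using (Subset; _∈_; _∉_; ⁅_⁆; ∣_∣; _-_)
open import Data.Fin.Subset.Properties
  using (_∈?_; x∉⁅y⁆⇒x≢y; x∈p∧x≢y⇒x∈p-y; x∈p⇒∣p-x∣<∣p∣)
open import Data.Vec.Properties using (lookup⇒[]=; []=⇒lookup; lookup∘tabulate)
open import Data.Product using (_,_)
open import Function.Bundles using (Equivalence)
open import Relation.Nullary using (yes; no; contradiction)
open import Relation.Binary.PropositionalEquality using (_≡_; _≢_; trans; sym; subst)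

private
  variable
    n : ℕ

∈-nbhd⁺ : (G : Graph n) {u x : Fin n} → Adj G u x → x ∈ nbhd G u
∈-nbhd⁺ G {u} {x} u~x =
  lookup⇒[]= x (nbhd G u) (trans (lookup∘tabulate (adj G u) x) (Equivalence.to T-≡ u~x))

∈-nbhd⁻ : (G : Graph n) {u x : Fin n} → x ∈ nbhd G u → Adj G u x
∈-nbhd⁻ G {u} {x} x∈N =
  Equivalence.from T-≡ (trans (sym (lookup∘tabulate (adj G u) x)) ([]=⇒lookup x∈N))

3≤∣p∣ : {p : Subset n} {a b c : Fin n} → a ∈ p → b ∈ p → c ∈ p →
        a ≢ b → a ≢ c → b ≢ c → 3 ≤ ∣ p ∣
3≤∣p∣ {p = p} {a} {b} {c} a∈p b∈p c∈p a≢b a≢c b≢c =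
  remove a∈p (remove b∈p-a (remove c∈p-a-b z≤n))
  where
    remove : ∀ {k x} {q : Subset n} → x ∈ q → k ≤ ∣ q - x ∣ → suc k ≤ ∣ q ∣
    remove x∈q k≤ = ≤-trans (s≤s k≤) (x∈p⇒∣p-x∣<∣p∣ x∈q)
    b∈p-a = x∈p∧x≢y⇒x∈p-y b∈p (λ b≡a → a≢b (sym b≡a))
    c∈p-a-b = x∈p∧x≢y⇒x∈p-y (x∈p∧x≢y⇒x∈p-y c∈p (λ c≡a → a≢c (sym c≡a)))
                             (λ c≡b → b≢c (sym c≡b))

AtMostOneNeighbourOutside : Graph n → Subset n → Fin n → Set
AtMostOneNeighbourOutside G S w =
  ∀ {x y} → Adj G w x → Adj G w y → x ∉ S → y ∉ S → x ≡ y

nbhd⊆Closure : (G : Graph n) {S : Subset n} {w x : Fin n} →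
               AtMostOneNeighbourOutside G S w → Adj G w x → Closure G S x
nbhd⊆Closure G {S} {w} {x} atMostOne w~x with x ∈? S
... | yes x∈S = initial x∈S
... | no x∉S = force w w~x others
  where
    others : ∀ y → Adj G w y → y ≢ x → Closure G S y
    others y w~y y≢x with y ∈? S
    ... | yes y∈S = initial y∈S
    ... | no y∉S = contradiction (atMostOne w~y w~x y∉S x∉S) y≢x

Closure-⊆ : (G : Graph n) {S T : Subset n} →
            (∀ {x} → x ∈ T → Closure G S x) → ∀ {y} → Closure G T y → Closure G S y
Closure-⊆ G T⊆S̄ (initial y∈T) = T⊆S̄ y∈T
Closure-⊆ G T⊆S̄ (force w w~y others) =
  force w w~y (λ x w~x x≢y → Closure-⊆ G T⊆S̄ (others x w~x x≢y))

FailedSkewZF-⊆Closure : (G : Graph n) {S T : Subset n} →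
                        (∀ {x} → x ∈ T → Closure G S x) →
                        FailedSkewZF G S → FailedSkewZF G T
FailedSkewZF-⊆Closure G T⊆S̄ (u , ¬u∈S̄) = u , λ u∈T̄ → ¬u∈S̄ (Closure-⊆ G T⊆S̄ u∈T̄)

degree≡2⇒atMostOneNeighbourOutside : (G : Graph n) {u v : Fin n} →
  Adj G u v → degree G u ≡ 2 → AtMostOneNeighbourOutside G ⁅ v ⁆ u
degree≡2⇒atMostOneNeighbourOutside G {u} {v} u~v deg≡2 {x} {y} u~x u~y x∉v y∉v
  with x ≟ y
... | yes x≡y = x≡y
... | no x≢y = contradiction (subst (3 ≤_) deg≡2 three≤deg) λ { (s≤s (s≤s ())) }
  where
    three≤deg : 3 ≤ degree G u
    three≤deg = 3≤∣p∣ (∈-nbhd⁺ G u~v) (∈-nbhd⁺ G u~x) (∈-nbhd⁺ G u~y)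
                      (λ v≡x → x∉⁅y⁆⇒x≢y x∉v (sym v≡x))
                      (λ v≡y → x∉⁅y⁆⇒x≢y y∉v (sym v≡y))
                      x≢y

lemma3p6 : ∀ {n : ℕ} (G : Graph n) → FminusEq G 1 →
    (v : Fin n) → FailedSkewZF G ⁅ v ⁆ →
    ∀ (u : Fin n) → Adj G v u → degree G u ≢ 2
lemma3p6 G (_ , maximal) v ⁅v⁆-fails u v~u deg≡2 =
  contradiction (subst (_≤ 1) deg≡2 (maximal (nbhd G u) N-fails)) λ { (s≤s ()) }
  where
    u~v : Adj G u v
    u~v = subst T (Graph.sym G v u) v~u
    N-fails : FailedSkewZF G (nbhd G u)
    N-fails = FailedSkewZF-⊆Closure G
      (λ x∈N → nbhd⊆Closure G (degree≡2⇒atMostOneNeighbourOutside G u~v deg≡2) (∈-nbhd⁻ G x∈N))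
      ⁅v⁆-fails
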